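{- Let $p$ be a prime and $n\ge k\ge 1$ integers such that $S(n,k)$ is a minimum zero case. Then $\nu_p(S(n+1,k+1))=\nu_p(S(n,k))$ and $\epsilon_p(S(n+1,k+1))\equiv\epsilon_p(S(n,k)) \pmod p$.
   Context: $S(n,k)$ is the Stirling number of the second kind, $\nu_p$ the $p$-adic valuation, $\sigma_p(m)$ the base-$p$ digit sum, and $\epsilon_p(x)=p^{ -\nu_p(x)}x$ the unit part of a nonzero rational $x$. $S(n,k)$ is called a minimum zero case if $\nu_p(S(n,k)) = (\sigma_p(k)-\sigma_p(n))/(p-1)$. -}

module Defs where

open import Data.Nat using (ℕ; zero; suc; _+_; _*_; _∸_; _^_; _≤_; NonZero)
open import Data.Nat.DivMod using (_/_; _%_)
open import Data.Nat.Properties using (_≟_; m^n≢0)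
open import Relation.Nullary using (yes; no)

S : ℕ → ℕ → ℕ
S zero    zero    = 1
S zero    (suc k) = 0
S (suc n) zero    = 0
S (suc n) (suc k) = suc k * S n (suc k) + S n k

-- p-adic valuation with fuel (fuel x suffices for p ≥ 2, since p^ν ≤ x).
νAux : ℕ → (p x : ℕ) → .{{NonZero p}} → ℕ
νAux zero     p x       = 0
νAux (suc f)  p zero    = 0
νAux (suc f)  p (suc x) with suc x % p ≟ 0
... | yes _ = suc (νAux f p (suc x / p))
... | no  _ = 0

-- ν_p(x): largest v with p^v ∣ x (for x ≠ 0, p prime; value at 0 unused).
ν : (p x : ℕ) → .{{NonZero p}} → ℕ
ν p x = νAux x p x

ε : (p x : ℕ) → .{{NonZero p}} → ℕ
ε p x = _/_ x (p ^ ν p x) {{m^n≢0 p (ν p x)}}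

-- base-p digit sum with fuel (fuel x suffices for p ≥ 2).
σAux : ℕ → (p x : ℕ) → .{{NonZero p}} → ℕ
σAux zero    p x = 0
σAux (suc f) p x = x % p + σAux f p (x / p)

σ : (p x : ℕ) → .{{NonZero p}} → ℕ
σ p x = σAux x p x

-- S(n,k) is a minimum zero case: ν_p(S(n,k)) = (σ_p(k) − σ_p(n))/(p−1),
-- written without division/subtraction as (p−1)·ν_p(S(n,k)) + σ_p(n) = σ_p(k).
MinimumZeroCase : (p n k : ℕ) → .{{NonZero p}} → Set
MinimumZeroCase p n k = (p ∸ 1) * ν p (S n k) + σ p n ≡ σ p k
  where open import Relation.Binary.PropositionalEquality using (_≡_)

module Submission where

open import Defs
open import Data.Nat using (ℕ; suc; _≤_; NonZero)
open import Data.Nat.DivMod using (_%_)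
open import Data.Nat.Primality using (Prime)
open import Data.Product using (_×_)
open import Relation.Binary.PropositionalEquality using (_≡_)

open import Data.Nat using (zero; _+_; _*_; _∸_; _^_; _<_; _!; z≤n; s≤s; >-nonZero; >-nonZero⁻¹; nonTrivial⇒n>1)
open import Data.Nat.Properties
open import Data.Nat.DivMod
open import Data.Nat.Divisibility
open import Data.Nat.Induction using (<-rec)
open import Data.Nat.Primality using (euclidsLemma; prime⇒nonTrivial)
open import Data.Nat.Combinatorics using (_C_; nCk+nC[k+1]≡[n+1]C[k+1]; nCn≡1; k>n⇒nCk≡0; k![n∸k]!∣n!; nCk≡n!/k![n-k]!)
open import Data.Nat.Tactic.RingSolver using (solve-∀)
open import Data.Product using (_,_; proj₁; proj₂; ∃₂)
open import Data.Sum using (_⊎_; inj₁; inj₂; [_,_]′)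
open import Relation.Nullary using (yes; no; contradiction)
open import Relation.Binary.PropositionalEquality

-- Write ν = ν_p(S(n,k)). By the recurrence S(n+1,k+1) = (k+1) S(n,k+1) + S(n,k) it suffices to
-- show p^{ν+1} ∣ (k+1) S(n,k+1): then S(n+1,k+1) = p^ν (p w + ε_p(S(n,k))), whose valuation is ν
-- and whose unit part is ≡ ε_p(S(n,k)) (mod p). That divisibility comes from the lower bound
--   p^m ∣ k! S(n,k)   whenever   (p − 1) m + σ_p(n) < k + (p − 1),
-- proved by induction on k via the convolution S(n+1,k+1) = ∑_b C(n,b) S(b,k) and Kummer's count
-- (p − 1) ν_p(C(n,b)) = σ_p(b) + σ_p(n − b) − σ_p(n). At level k+1 with m = ν_p(k!) + ν + 1 the
-- hypothesis is exactly the minimum zero condition plus Legendre's formula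
-- (p − 1) ν_p(k!) = k − σ_p(k); cancelling k! then gives p^{ν+1} ∣ (k+1) S(n,k+1).

sumBelow : ℕ → (ℕ → ℕ) → ℕ
sumBelow zero    f = 0
sumBelow (suc n) f = sumBelow n f + f n

infix 6.5 sumBelow
syntax sumBelow n (λ b → e) = ∑[ b < n ] e

sum-shift : ∀ n (f : ℕ → ℕ) → ∑[ b < suc n ] f b ≡ f 0 + ∑[ b < n ] f (suc b)
sum-shift zero    f = +-comm 0 (f 0)
sum-shift (suc n) f = trans (cong (_+ f (suc n)) (sum-shift n f)) (+-assoc (f 0) _ (f (suc n)))

sum-cong : ∀ n {f g : ℕ → ℕ} → (∀ b → f b ≡ g b) → ∑[ b < n ] f b ≡ ∑[ b < n ] g b
sum-cong zero    f≗g = refl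
sum-cong (suc n) f≗g = cong₂ _+_ (sum-cong n f≗g) (f≗g n)

sum-zero : ∀ n → ∑[ b < n ] 0 ≡ 0
sum-zero zero    = refl
sum-zero (suc n) = trans (+-identityʳ _) (sum-zero n)

sum-+ : ∀ n (f g : ℕ → ℕ) → ∑[ b < n ] (f b + g b) ≡ ∑[ b < n ] f b + ∑[ b < n ] g b
sum-+ zero    f g = refl
sum-+ (suc n) f g = trans (cong (_+ (f n + g n)) (sum-+ n f g)) (interchange (∑[ b < n ] f b) (∑[ b < n ] g b) (f n) (g n))
  where
  interchange : ∀ a b c d → a + b + (c + d) ≡ a + c + (b + d)
  interchange = solve-∀

sum-*ˡ : ∀ n c (f : ℕ → ℕ) → ∑[ b < n ] (c * f b) ≡ c * (∑[ b < n ] f b)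
sum-*ˡ zero    c f = sym (*-zeroʳ c)
sum-*ˡ (suc n) c f = trans (cong (_+ c * f n) (sum-*ˡ n c f)) (sym (*-distribˡ-+ c _ (f n)))

sum-∣ : ∀ n d (f : ℕ → ℕ) → (∀ b → b < n → d ∣ f b) → d ∣ ∑[ b < n ] f b
sum-∣ zero    d f d∣f = d ∣0
sum-∣ (suc n) d f d∣f = ∣m∣n⇒∣m+n (sum-∣ n d f (λ b b<n → d∣f b (m<n⇒m<1+n b<n))) (d∣f n ≤-refl)

stirling-binomial : ∀ n k → S (suc n) (suc k) ≡ ∑[ b < suc n ] (n C b) * S b k
stirling-binomial zero    k = trans (cong (_+ S 0 k) (*-zeroʳ k)) (sym (+-identityʳ (S 0 k)))
stirling-binomial (suc n) k = sym (begin
  ∑[ b < suc (suc n) ] (suc n C b) * S b k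
    ≡⟨ sum-shift (suc n) (λ b → (suc n C b) * S b k) ⟩
  1 * S 0 k + ∑[ b < suc n ] (suc n C suc b) * S (suc b) k
    ≡⟨ cong (1 * S 0 k +_) pascal ⟩
  1 * S 0 k + (shifted + ∑[ b < suc n ] (n C suc b) * S (suc b) k)
    ≡⟨ swap-front (1 * S 0 k) shifted _ ⟩
  shifted + ((n C 0) * S 0 k + ∑[ b < suc n ] (n C suc b) * S (suc b) k)
    ≡⟨ cong (shifted +_) (sym (sum-shift (suc n) (λ b → (n C b) * S b k))) ⟩
  shifted + ∑[ b < suc (suc n) ] (n C b) * S b k
    ≡⟨ cong (shifted +_) (trans (cong (T k +_) top-vanishes) (+-identityʳ (T k))) ⟩
  shifted + T k
    ≡⟨ cong₂ _+_ (shifted-sum k) (sym (stirling-binomial n k)) ⟩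
  (k * S (suc n) (suc k) + S (suc n) k) + S (suc n) (suc k)
    ≡⟨ recurrence-form (S (suc n) (suc k)) (S (suc n) k) k ⟩
  S (suc (suc n)) (suc k) ∎)
  where
  open ≡-Reasoning
  T : ℕ → ℕ
  T j = ∑[ b < suc n ] (n C b) * S b j
  shifted : ℕ
  shifted = ∑[ b < suc n ] (n C b) * S (suc b) k
  pascal : ∑[ b < suc n ] (suc n C suc b) * S (suc b) k
         ≡ shifted + ∑[ b < suc n ] (n C suc b) * S (suc b) k
  pascal = trans (sum-cong (suc n) (λ b → trans
             (cong (_* S (suc b) k) (sym (nCk+nC[k+1]≡[n+1]C[k+1] n b)))
             (*-distribʳ-+ (S (suc b) k) (n C b) (n C suc b))))
           (sum-+ (suc n) (λ b → (n C b) * S (suc b) k) (λ b → (n C suc b) * S (suc b) k))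
  top-vanishes : (n C suc n) * S (suc n) k ≡ 0
  top-vanishes = cong (_* S (suc n) k) (k>n⇒nCk≡0 {n} (n<1+n n))
  shifted-sum : ∀ k → ∑[ b < suc n ] (n C b) * S (suc b) k ≡ k * S (suc n) (suc k) + S (suc n) k
  shifted-sum zero = trans (sum-cong (suc n) (λ b → *-zeroʳ (n C b))) (sum-zero (suc n))
  shifted-sum (suc k) = begin
    ∑[ b < suc n ] (n C b) * (suc k * S b (suc k) + S b k)
      ≡⟨ sum-cong (suc n) (λ b → distribute (n C b) (suc k) (S b (suc k)) (S b k)) ⟩
    ∑[ b < suc n ] (suc k * ((n C b) * S b (suc k)) + (n C b) * S b k)
      ≡⟨ sum-+ (suc n) (λ b → suc k * ((n C b) * S b (suc k))) (λ b → (n C b) * S b k) ⟩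
    ∑[ b < suc n ] suc k * ((n C b) * S b (suc k)) + T k
      ≡⟨ cong (_+ T k) (sum-*ˡ (suc n) (suc k) (λ b → (n C b) * S b (suc k))) ⟩
    suc k * T (suc k) + T k
      ≡⟨ sym (cong₂ (λ x y → suc k * x + y) (stirling-binomial n (suc k)) (stirling-binomial n k)) ⟩
    suc k * S (suc n) (suc (suc k)) + S (suc n) (suc k) ∎
    where
    distribute : ∀ c m x y → c * (m * x + y) ≡ m * (c * x) + c * y
    distribute = solve-∀
  swap-front : ∀ a s t → a + (s + t) ≡ s + (a + t)
  swap-front = solve-∀
  recurrence-form : ∀ x y k → (k * x + y) + x ≡ suc k * x + y
  recurrence-form = solve-∀

stirling-binomial-below : ∀ n k → suc k * S n (suc k) ≡ ∑[ b < n ] (n C b) * S b k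
stirling-binomial-below n k = +-cancelʳ-≡ (S n k) _ _ (begin
  suc k * S n (suc k) + S n k            ≡⟨ stirling-binomial n k ⟩
  ∑[ b < n ] (n C b) * S b k + (n C n) * S n k ≡⟨ cong (λ c → ∑[ b < n ] (n C b) * S b k + c * S n k) (nCn≡1 n) ⟩
  ∑[ b < n ] (n C b) * S b k + 1 * S n k ≡⟨ cong (∑[ b < n ] (n C b) * S b k +_) (*-identityˡ (S n k)) ⟩
  ∑[ b < n ] (n C b) * S b k + S n k ∎)
  where open ≡-Reasoning

factorial-stirling-binomial : ∀ n k → suc k ! * S n (suc k) ≡ ∑[ b < n ] (n C b) * (k ! * S b k)
factorial-stirling-binomial n k = begin
  suc k ! * S n (suc k)                 ≡⟨ regroup (suc k) (k !) (S n (suc k)) ⟩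
  k ! * (suc k * S n (suc k))           ≡⟨ cong (k ! *_) (stirling-binomial-below n k) ⟩
  k ! * (∑[ b < n ] (n C b) * S b k)    ≡⟨ sum-*ˡ n (k !) (λ b → (n C b) * S b k) ⟨
  ∑[ b < n ] k ! * ((n C b) * S b k)    ≡⟨ sum-cong n (λ b → regroup′ (k !) (n C b) (S b k)) ⟩
  ∑[ b < n ] (n C b) * (k ! * S b k)    ∎
  where
  open ≡-Reasoning
  regroup : ∀ m f s → (m * f) * s ≡ f * (m * s)
  regroup = solve-∀
  regroup′ : ∀ f c s → f * (c * s) ≡ c * (f * s)
  regroup′ = solve-∀

S-positive : ∀ {n k} → k ≤ n → 0 < S (suc n) (suc k)
S-positive {zero}  {zero}  _         = s≤s z≤n
S-positive {suc n} {zero}  _         = ≤-trans (S-positive {n} z≤n) (≤-trans (m≤m+n _ 0) (m≤m+n _ 0))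
S-positive {suc n} {suc k} (s≤s k≤n) = ≤-trans (S-positive k≤n) (m≤n+m (S (suc n) (suc k)) (suc (suc k) * S (suc n) (suc (suc k))))

positive-* : ∀ {m n} → 0 < m → 0 < n → 0 < m * n
positive-* {suc m} {suc n} _ _ = s≤s z≤n

factorial-positive : ∀ n → 0 < n !
factorial-positive n = >-nonZero⁻¹ (n !) {{n !≢0}}

power-∣ : ∀ a {m c} → m ≤ c → a ^ m ∣ a ^ c
power-∣ a {m} {c} m≤c = divides (a ^ (c ∸ m)) (begin
  a ^ c               ≡⟨ cong (a ^_) (m+[n∸m]≡n m≤c) ⟨
  a ^ (m + (c ∸ m))   ≡⟨ ^-distribˡ-+-* a m (c ∸ m) ⟩
  a ^ m * a ^ (c ∸ m) ≡⟨ *-comm (a ^ m) _ ⟩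
  a ^ (c ∸ m) * a ^ m ∎)
  where open ≡-Reasoning

-- Bookkeeping for the lower bound: if (q·c + s_n) splits as s_b + s_d with s_d > 0, a budget
-- q (c + m) + s_n < (k+1) + q for (n, c + m) leaves the budget q m + s_b < k + q for (b, m).
shift-budget : ∀ q c m sn sb sd k → q * (c + m) + sn < suc k + q → q * c + sn ≡ sb + sd → 0 < sd →
               q * m + sb < k + q
shift-budget q c m sn sb sd k budget kummer 0<sd = ≤-pred (begin-strict
  suc (q * m + sb)          <⟨ s≤s (m<m+n (q * m + sb) 0<sd) ⟩
  suc (q * m + sb + sd)     ≡⟨ cong suc (regroup q c m sn sb sd kummer) ⟩
  suc (q * (c + m) + sn)    ≤⟨ budget ⟩
  suc k + q                 ∎)
  where
  open ≤-Reasoning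
  regroup : ∀ q c m sn sb sd → q * c + sn ≡ sb + sd → q * m + sb + sd ≡ q * (c + m) + sn
  regroup q c m sn sb sd kummer = begin-equality
    q * m + sb + sd       ≡⟨ +-assoc (q * m) sb sd ⟩
    q * m + (sb + sd)     ≡⟨ cong (q * m +_) kummer ⟨
    q * m + (q * c + sn)  ≡⟨ distribute q c m sn ⟩
    q * (c + m) + sn      ∎
    where
    distribute : ∀ q c m sn → q * m + (q * c + sn) ≡ q * (c + m) + sn
    distribute = solve-∀

-- Base-p digits, valuation and unit part for an arbitrary base p ≥ 2.
module Valuation (p : ℕ) .{{_ : NonZero p}} (1<p : 1 < p) where

  divMod-unique : ∀ r d → r < p → (r + d * p) % p ≡ r × (r + d * p) / p ≡ d
  divMod-unique r d r<p = remainder≡r , quotient≡d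
    where
    remainder≡r : (r + d * p) % p ≡ r
    remainder≡r = trans ([m+kn]%n≡m%n r d p) (m<n⇒m%n≡m r<p)
    quotient≡d : (r + d * p) / p ≡ d
    quotient≡d = begin
      (r + d * p) / p   ≡⟨ +-distrib-/ r (d * p) no-carry ⟩
      r / p + d * p / p ≡⟨ cong₂ _+_ (m<n⇒m/n≡0 r<p) (m*n/n≡m d p) ⟩
      d                 ∎
      where
      open ≡-Reasoning
      no-carry : r % p + d * p % p < p
      no-carry = subst (_< p) (sym (trans (cong₂ _+_ (m<n⇒m%n≡m r<p) (m*n%n≡0 d p)) (+-identityʳ r))) r<p

  successor-digits : ∀ x → (suc x % p ≡ suc (x % p) × suc x / p ≡ x / p)
                         ⊎ (suc x % p ≡ 0 × suc x / p ≡ suc (x / p))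
  successor-digits x with suc (x % p) <? p
  ... | yes last<p = inj₁ (subst (λ y → y % p ≡ suc (x % p) × y / p ≡ x / p)
                            (sym (cong suc (m≡m%n+[m/n]*n x p))) (divMod-unique _ _ last<p))
  ... | no last≮p = inj₂ (subst (λ y → y % p ≡ 0 × y / p ≡ suc (x / p)) carry
                            (divMod-unique 0 (suc (x / p)) (>-nonZero⁻¹ p)))
    where
    last≡p : suc (x % p) ≡ p
    last≡p = ≤-antisym (m%n<n x p) (≮⇒≥ last≮p)
    carry : suc (x / p) * p ≡ suc x
    carry = sym (trans (cong suc (m≡m%n+[m/n]*n x p)) (cong (_+ x / p * p) last≡p))

  -- Since x / p < x, fuel x suffices for the digit-sum and valuation recursions.
  quotient-fuel : ∀ x f → x ≤ suc f → x / p ≤ f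
  quotient-fuel zero    f _     = subst (_≤ f) (sym (0/n≡0 p)) z≤n
  quotient-fuel (suc x) f x≤1+f = ≤-pred (≤-trans (m/n<m (suc x) p 1<p) x≤1+f)

  0%p≡0 : 0 % p ≡ 0
  0%p≡0 = m<n⇒m%n≡m (>-nonZero⁻¹ p)

  σAux-zero : ∀ f → σAux f p 0 ≡ 0
  σAux-zero zero    = refl
  σAux-zero (suc f) = cong₂ _+_ 0%p≡0 (trans (cong (λ y → σAux f p y) (0/n≡0 p)) (σAux-zero f))

  σAux-fuel : ∀ f g x → x ≤ f → x ≤ g → σAux f p x ≡ σAux g p x
  σAux-fuel zero    g       zero _ _ = sym (σAux-zero g)
  σAux-fuel (suc f) zero    zero _ _ = σAux-zero (suc f)
  σAux-fuel (suc f) (suc g) x x≤f x≤g =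
    cong (x % p +_) (σAux-fuel f g (x / p) (quotient-fuel x f x≤f) (quotient-fuel x g x≤g))

  σ-step : ∀ x → σ p x ≡ x % p + σ p (x / p)
  σ-step zero    = sym (cong₂ _+_ 0%p≡0 (cong (λ y → σ p y) (0/n≡0 p)))
  σ-step (suc x) = cong (suc x % p +_) (σAux-fuel x (suc x / p) (suc x / p) (quotient-fuel (suc x) x ≤-refl) ≤-refl)

  σ-positive : ∀ x → 0 < x → 0 < σ p x
  σ-positive = <-rec (λ x → 0 < x → 0 < σ p x) step
    where
    step : ∀ x → (∀ {y} → y < x → 0 < y → 0 < σ p y) → 0 < x → 0 < σ p x
    step x rec 0<x with x % p in x%p
    ... | suc r = subst (0 <_) (sym (trans (σ-step x) (cong (_+ σ p (x / p)) x%p))) (s≤s z≤n)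
    ... | zero  = subst (0 <_) (sym (trans (σ-step x) (cong (_+ σ p (x / p)) x%p)))
                    (rec (m/n<m x p {{>-nonZero 0<x}} 1<p) (m≥n⇒m/n>0 p≤x))
      where
      p≤x : p ≤ x
      p≤x = ∣⇒≤ {{>-nonZero 0<x}} (m%n≡0⇒n∣m x p x%p)

  indivisible⇒positive : ∀ {u} → p ∤ u → 0 < u
  indivisible⇒positive {zero}  p∤0 = contradiction (p ∣0) p∤0
  indivisible⇒positive {suc u} _   = s≤s z≤n

  p*x/p≡x : ∀ x → p * x / p ≡ x
  p*x/p≡x x = trans (cong (_/ p) (*-comm p x)) (m*n/n≡m x p)

  p∣p^[1+c]*v : ∀ c v → p ∣ p ^ suc c * v
  p∣p^[1+c]*v c v = ∣-trans (m∣m*n (p ^ c)) (m∣m*n v)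

  a<p^a : ∀ a → a < p ^ a
  a<p^a zero    = s≤s z≤n
  a<p^a (suc a) = begin-strict
    suc a     ≤⟨ a<p^a a ⟩
    p ^ a     <⟨ m<m*n (p ^ a) p {{m^n≢0 p a}} 1<p ⟩
    p ^ a * p ≡⟨ *-comm (p ^ a) p ⟩
    p * p ^ a ∎
    where open ≤-Reasoning

  νAux-divisible : ∀ f y → 0 < y → p ∣ y → νAux (suc f) p y ≡ suc (νAux f p (y / p))
  νAux-divisible f (suc y) _ p∣y with suc y % p ≟ 0
  ... | yes _    = refl
  ... | no  r≢0 = contradiction (n∣m⇒m%n≡0 (suc y) p p∣y) r≢0

  νAux-indivisible : ∀ f y → p ∤ y → νAux (suc f) p y ≡ 0
  νAux-indivisible f zero    p∤0 = contradiction (p ∣0) p∤0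
  νAux-indivisible f (suc y) p∤y with suc y % p ≟ 0
  ... | yes r≡0 = contradiction (m%n≡0⇒n∣m (suc y) p r≡0) p∤y
  ... | no  _   = refl

  νAux-power : ∀ a f u → a ≤ f → p ∤ u → νAux f p (p ^ a * u) ≡ a
  νAux-power zero    zero    u _ _   = refl
  νAux-power zero    (suc f) u _ p∤u = trans (cong (λ y → νAux (suc f) p y) (*-identityˡ u)) (νAux-indivisible f u p∤u)
  νAux-power (suc a) (suc f) u (s≤s a≤f) p∤u = begin
    νAux (suc f) p (p ^ suc a * u)
      ≡⟨ νAux-divisible f _ (positive-* (m^n>0 p (suc a)) (indivisible⇒positive p∤u)) (p∣p^[1+c]*v a u) ⟩
    suc (νAux f p (p ^ suc a * u / p))
      ≡⟨ cong (λ y → suc (νAux f p y)) (trans (cong (_/ p) (*-assoc p (p ^ a) u)) (p*x/p≡x (p ^ a * u))) ⟩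
    suc (νAux f p (p ^ a * u))
      ≡⟨ cong suc (νAux-power a f u a≤f p∤u) ⟩
    suc a ∎
    where open ≡-Reasoning

  ν-unique : ∀ a u → p ∤ u → ν p (p ^ a * u) ≡ a
  ν-unique a u p∤u = νAux-power a (p ^ a * u) u a≤p^a*u p∤u
    where
    a≤p^a*u : a ≤ p ^ a * u
    a≤p^a*u = ≤-trans (<⇒≤ (a<p^a a)) (m≤m*n (p ^ a) u {{>-nonZero (indivisible⇒positive p∤u)}})

  ε-unique : ∀ a u → p ∤ u → ε p (p ^ a * u) ≡ u
  ε-unique a u p∤u = begin
    _/_ (p ^ a * u) (p ^ ν p (p ^ a * u)) {{m^n≢0 p (ν p (p ^ a * u))}}
      ≡⟨ /-congʳ {{m^n≢0 p (ν p (p ^ a * u))}} {{m^n≢0 p a}} (cong (p ^_) (ν-unique a u p∤u)) ⟩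
    _/_ (p ^ a * u) (p ^ a) {{m^n≢0 p a}}
      ≡⟨ /-congˡ {{m^n≢0 p a}} (*-comm (p ^ a) u) ⟩
    _/_ (u * p ^ a) (p ^ a) {{m^n≢0 p a}}
      ≡⟨ m*n/n≡m u (p ^ a) {{m^n≢0 p a}} ⟩
    u ∎
    where open ≡-Reasoning

  factorise : ∀ x → 0 < x → ∃₂ λ a u → x ≡ p ^ a * u × p ∤ u
  factorise = <-rec (λ x → 0 < x → ∃₂ λ a u → x ≡ p ^ a * u × p ∤ u) step
    where
    step : ∀ x → (∀ {y} → y < x → 0 < y → ∃₂ λ a u → y ≡ p ^ a * u × p ∤ u) →
           0 < x → ∃₂ λ a u → x ≡ p ^ a * u × p ∤ u
    step x rec 0<x with p ∣? x
    ... | no p∤x = 0 , x , sym (*-identityˡ x) , p∤x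
    ... | yes (divides y x≡y*p) with rec (subst (y <_) (sym x≡y*p) (m<m*n y p {{y≢0}} 1<p)) (>-nonZero⁻¹ y {{y≢0}})
      where
      y≢0 : NonZero y
      y≢0 = m*n≢0⇒m≢0 y {{>-nonZero (subst (0 <_) x≡y*p 0<x)}}
    ...   | a , u , y≡p^a*u , p∤u = suc a , u , x≡p^[1+a]*u , p∤u
      where
      x≡p^[1+a]*u : x ≡ p ^ suc a * u
      x≡p^[1+a]*u = begin
        x             ≡⟨ x≡y*p ⟩
        y * p         ≡⟨ *-comm y p ⟩
        p * y         ≡⟨ cong (p *_) y≡p^a*u ⟩
        p * (p ^ a * u) ≡⟨ *-assoc p (p ^ a) u ⟨
        p ^ suc a * u ∎
        where open ≡-Reasoning

  ν-ε-split : ∀ x → 0 < x → x ≡ p ^ ν p x * ε p x × p ∤ ε p x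
  ν-ε-split x 0<x with factorise x 0<x
  ... | a , u , refl , p∤u =
    sym (cong₂ (λ b v → p ^ b * v) (ν-unique a u p∤u) (ε-unique a u p∤u)) ,
    subst (p ∤_) (sym (ε-unique a u p∤u)) p∤u

  -- Adding one to x clears the c trailing digits p − 1 of x, where p^c ∥ x + 1:
  -- σ_p(x+1) + (p−1) c = σ_p(x) + 1.
  σ-successor : ∀ x c v → suc x ≡ p ^ c * v → p ∤ v → σ p (suc x) + (p ∸ 1) * c ≡ σ p x + 1
  σ-successor x zero v x+1≡v p∤v with successor-digits x
  ... | inj₂ (last≡0 , _) = contradiction (subst (p ∣_) (trans x+1≡v (*-identityˡ v)) (m%n≡0⇒n∣m (suc x) p last≡0)) p∤v
  ... | inj₁ (last , quot) = begin
    σ p (suc x) + (p ∸ 1) * 0            ≡⟨ trans (cong (σ p (suc x) +_) (*-zeroʳ (p ∸ 1))) (+-identityʳ _) ⟩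
    σ p (suc x)                          ≡⟨ σ-step (suc x) ⟩
    suc x % p + σ p (suc x / p)          ≡⟨ cong₂ (λ r q → r + σ p q) last quot ⟩
    suc (x % p) + σ p (x / p)            ≡⟨ +-comm 1 (x % p + σ p (x / p)) ⟩
    x % p + σ p (x / p) + 1              ≡⟨ cong (_+ 1) (σ-step x) ⟨
    σ p x + 1                            ∎
    where open ≡-Reasoning
  σ-successor x (suc c) v x+1≡p^[1+c]*v p∤v with successor-digits x
  ... | inj₁ (last , _) = contradiction (trans (sym (n∣m⇒m%n≡0 (suc x) p p∣x+1)) last) 0≢1+n
    where
    p∣x+1 : p ∣ suc x
    p∣x+1 = subst (p ∣_) (sym x+1≡p^[1+c]*v) (p∣p^[1+c]*v c v)
  ... | inj₂ (last≡0 , quot) = begin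
    σ p (suc x) + P1 * suc c             ≡⟨ cong (_+ P1 * suc c) (σ-step (suc x)) ⟩
    suc x % p + σ p (suc x / p) + P1 * suc c
                                         ≡⟨ cong₂ (λ r q → r + σ p q + P1 * suc c) last≡0 quot ⟩
    σ p (suc (x / p)) + P1 * suc c       ≡⟨ regroup (σ p (suc (x / p))) P1 c ⟩
    (σ p (suc (x / p)) + P1 * c) + P1    ≡⟨ cong (_+ P1) (σ-successor (x / p) c v x/p+1≡p^c*v p∤v) ⟩
    (σ p (x / p) + 1) + P1               ≡⟨ regroup′ (σ p (x / p)) P1 ⟩
    P1 + σ p (x / p) + 1                 ≡⟨ cong (λ r → r + σ p (x / p) + 1) (%-pred-≡0 last≡0) ⟨
    x % p + σ p (x / p) + 1              ≡⟨ cong (_+ 1) (σ-step x) ⟨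
    σ p x + 1                            ∎
    where
    open ≡-Reasoning
    P1 : ℕ
    P1 = p ∸ 1
    x/p+1≡p^c*v : suc (x / p) ≡ p ^ c * v
    x/p+1≡p^c*v = begin
      suc (x / p)             ≡⟨ quot ⟨
      suc x / p               ≡⟨ cong (_/ p) (trans x+1≡p^[1+c]*v (*-assoc p (p ^ c) v)) ⟩
      p * (p ^ c * v) / p     ≡⟨ p*x/p≡x (p ^ c * v) ⟩
      p ^ c * v               ∎
    regroup : ∀ s q c → s + q * suc c ≡ (s + q * c) + q
    regroup = solve-∀
    regroup′ : ∀ s q → (s + 1) + q ≡ q + s + 1
    regroup′ = solve-∀

  σ-successor-ν : ∀ x → σ p (suc x) + (p ∸ 1) * ν p (suc x) ≡ σ p x + 1
  σ-successor-ν x with ν-ε-split (suc x) (s≤s z≤n)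
  ... | x+1≡ , p∤ε = σ-successor x (ν p (suc x)) (ε p (suc x)) x+1≡ p∤ε

  valuation-∣ : ∀ x → p ^ ν p x ∣ x
  valuation-∣ zero    = (p ^ ν p 0) ∣0
  valuation-∣ (suc x) = divides (ε p (suc x)) (trans (proj₁ (ν-ε-split (suc x) (s≤s z≤n))) (*-comm _ (ε p (suc x))))

-- For a prime p, where Euclid's lemma makes ν_p additive.
module PrimeValuation (p : ℕ) .{{_ : NonZero p}} (p-prime : Prime p) where

  1<p : 1 < p
  1<p = nonTrivial⇒n>1 p {{prime⇒nonTrivial p-prime}}

  open Valuation p 1<p

  ∤-* : ∀ {u v} → p ∤ u → p ∤ v → p ∤ u * v
  ∤-* p∤u p∤v p∣uv = [ p∤u , p∤v ]′ (euclidsLemma _ _ p-prime p∣uv)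

  ν-* : ∀ x y → 0 < x → 0 < y → ν p (x * y) ≡ ν p x + ν p y
  ν-* x y 0<x 0<y with ν-ε-split x 0<x | ν-ε-split y 0<y
  ... | x≡ , p∤εx | y≡ , p∤εy = begin
    ν p (x * y)
      ≡⟨ cong (λ z → ν p z) (trans (cong₂ _*_ x≡ y≡) (regroup (p ^ ν p x) (ε p x) (p ^ ν p y) (ε p y))) ⟩
    ν p ((p ^ ν p x * p ^ ν p y) * (ε p x * ε p y))
      ≡⟨ cong (λ z → ν p (z * (ε p x * ε p y))) (^-distribˡ-+-* p (ν p x) (ν p y)) ⟨
    ν p (p ^ (ν p x + ν p y) * (ε p x * ε p y))
      ≡⟨ ν-unique (ν p x + ν p y) (ε p x * ε p y) (∤-* p∤εx p∤εy) ⟩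
    ν p x + ν p y ∎
    where
    open ≡-Reasoning
    regroup : ∀ a u b v → (a * u) * (b * v) ≡ (a * b) * (u * v)
    regroup = solve-∀

  legendre : ∀ n → (p ∸ 1) * ν p (n !) + σ p n ≡ n
  legendre zero = trans (cong (λ v → (p ∸ 1) * v + 0) (ν-unique 0 1 (>⇒∤ 1<p))) (cong (_+ 0) (*-zeroʳ (p ∸ 1)))
  legendre (suc n) = begin
    P1 * ν p (suc n * n !) + σ p (suc n)
      ≡⟨ cong (λ v → P1 * v + σ p (suc n)) (ν-* (suc n) (n !) (s≤s z≤n) (factorial-positive n)) ⟩
    P1 * (ν p (suc n) + ν p (n !)) + σ p (suc n)
      ≡⟨ regroup P1 (ν p (suc n)) (ν p (n !)) (σ p (suc n)) ⟩
    (σ p (suc n) + P1 * ν p (suc n)) + P1 * ν p (n !)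
      ≡⟨ cong (_+ P1 * ν p (n !)) (σ-successor-ν n) ⟩
    (σ p n + 1) + P1 * ν p (n !)
      ≡⟨ regroup′ (σ p n) (P1 * ν p (n !)) ⟩
    suc (P1 * ν p (n !) + σ p n)
      ≡⟨ cong suc (legendre n) ⟩
    suc n ∎
    where
    open ≡-Reasoning
    P1 : ℕ
    P1 = p ∸ 1
    regroup : ∀ q a b s → q * (a + b) + s ≡ (s + q * a) + q * b
    regroup = solve-∀
    regroup′ : ∀ s t → (s + 1) + t ≡ suc (t + s)
    regroup′ = solve-∀

  binomial-factorials : ∀ {n b} → b ≤ n → (n C b) * (b ! * (n ∸ b) !) ≡ n !
  binomial-factorials {n} {b} b≤n =
    trans (cong (_* (b ! * (n ∸ b) !)) (nCk≡n!/k![n-k]! b≤n)) (m/n*n≡m {{b !* (n ∸ b) !≢0}} (k![n∸k]!∣n! b≤n))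

  binomial-valuation : ∀ {n b} → b ≤ n → (p ∸ 1) * ν p (n C b) + σ p n ≡ σ p b + σ p (n ∸ b)
  binomial-valuation {n} {b} b≤n = +-cancelʳ-≡ (P1 * νb! + P1 * νm!) _ _ (begin
    (P1 * ν p (n C b) + σ p n) + (P1 * νb! + P1 * νm!)
      ≡⟨ regroup P1 (ν p (n C b)) νb! νm! (σ p n) ⟩
    P1 * (ν p (n C b) + (νb! + νm!)) + σ p n
      ≡⟨ cong (λ v → P1 * v + σ p n) (sym ν[n!]) ⟩
    P1 * ν p (n !) + σ p n
      ≡⟨ legendre n ⟩
    n
      ≡⟨ m+[n∸m]≡n b≤n ⟨
    b + (n ∸ b)
      ≡⟨ cong₂ _+_ (legendre b) (legendre (n ∸ b)) ⟨
    (P1 * νb! + σ p b) + (P1 * νm! + σ p (n ∸ b))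
      ≡⟨ regroup′ (P1 * νb!) (σ p b) (P1 * νm!) (σ p (n ∸ b)) ⟩
    (σ p b + σ p (n ∸ b)) + (P1 * νb! + P1 * νm!) ∎)
    where
    open ≡-Reasoning
    P1 νb! νm! : ℕ
    P1 = p ∸ 1
    νb! = ν p (b !)
    νm! = ν p ((n ∸ b) !)
    C-positive : 0 < n C b
    C-positive = >-nonZero⁻¹ (n C b) {{m*n≢0⇒m≢0 (n C b) {{subst NonZero (sym (binomial-factorials b≤n)) (n !≢0)}}}}
    ν[n!] : ν p (n !) ≡ ν p (n C b) + (νb! + νm!)
    ν[n!] = begin
      ν p (n !)                                   ≡⟨ cong (λ z → ν p z) (binomial-factorials b≤n) ⟨
      ν p ((n C b) * (b ! * (n ∸ b) !))           ≡⟨ ν-* _ _ C-positive (positive-* (factorial-positive b) (factorial-positive (n ∸ b))) ⟩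
      ν p (n C b) + ν p (b ! * (n ∸ b) !)         ≡⟨ cong (ν p (n C b) +_) (ν-* _ _ (factorial-positive b) (factorial-positive (n ∸ b))) ⟩
      ν p (n C b) + (νb! + νm!)                   ∎
    regroup : ∀ q c a b s → (q * c + s) + (q * a + q * b) ≡ q * (c + (a + b)) + s
    regroup = solve-∀
    regroup′ : ∀ a s b t → (a + s) + (b + t) ≡ (s + t) + (a + b)
    regroup′ = solve-∀

  prime-power-∣ : ∀ e {u y} → p ∤ u → p ^ e ∣ u * y → p ^ e ∣ y
  prime-power-∣ zero    {y = y} _ _ = 1∣ y
  prime-power-∣ (suc e) {u} {y} p∤u p^[1+e]∣uy with euclidsLemma u y p-prime (∣-trans (m∣m*n (p ^ e)) p^[1+e]∣uy)
  ... | inj₁ p∣u = contradiction p∣u p∤u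
  ... | inj₂ (divides y′ refl) = subst (p * p ^ e ∣_) (*-comm p y′) (*-monoʳ-∣ p (prime-power-∣ e p∤u p^e∣uy′))
    where
    p^e∣uy′ : p ^ e ∣ u * y′
    p^e∣uy′ = *-cancelˡ-∣ p (subst (p * p ^ e ∣_) (regroup u y′ p) p^[1+e]∣uy)
      where
      regroup : ∀ u y q → u * (y * q) ≡ q * (u * y)
      regroup = solve-∀

  valuation-cancel : ∀ a e {y} → 0 < a → p ^ (ν p a + e) ∣ a * y → p ^ e ∣ y
  valuation-cancel a e {y} 0<a p^[νa+e]∣ay with ν-ε-split a 0<a
  ... | a≡ , p∤εa = prime-power-∣ e p∤εa (*-cancelˡ-∣ (p ^ ν p a) {{m^n≢0 p (ν p a)}} (subst₂ _∣_ power-split ay-split p^[νa+e]∣ay))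
    where
    power-split : p ^ (ν p a + e) ≡ p ^ ν p a * p ^ e
    power-split = ^-distribˡ-+-* p (ν p a) e
    ay-split : a * y ≡ p ^ ν p a * (ε p a * y)
    ay-split = trans (cong (_* y) a≡) (*-assoc (p ^ ν p a) (ε p a) y)

  -- Lower bound for Stirling numbers: p^m ∣ k! S(n,k) whenever (p − 1) m + σ_p(n) < k + (p − 1).
  -- Induction on k through the binomial convolution, paying for each term with Kummer's count.
  stirling-lower-bound : ∀ k n m → (p ∸ 1) * m + σ p n < k + (p ∸ 1) → p ^ m ∣ k ! * S n k
  stirling-lower-bound zero    n zero    _      = 1∣ (S n 0 + 0)
  stirling-lower-bound zero    n (suc m) budget = contradiction budget (≤⇒≯ P1≤)
    where
    P1≤ : p ∸ 1 ≤ (p ∸ 1) * suc m + σ p n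
    P1≤ = ≤-trans (≤-trans (m≤m+n (p ∸ 1) ((p ∸ 1) * m)) (≤-reflexive (sym (*-suc (p ∸ 1) m)))) (m≤m+n _ (σ p n))
  stirling-lower-bound (suc k) n m budget =
    subst (p ^ m ∣_) (sym (factorial-stirling-binomial n k)) (sum-∣ n (p ^ m) (λ b → (n C b) * (k ! * S b k)) term)
    where
    term : ∀ b → b < n → p ^ m ∣ (n C b) * (k ! * S b k)
    term b b<n with m ≤? ν p (n C b)
    ... | yes m≤c = ∣-trans (power-∣ p m≤c) (∣-trans (valuation-∣ (n C b)) (m∣m*n (k ! * S b k)))
    ... | no  m≰c = subst (λ e → p ^ e ∣ (n C b) * (k ! * S b k)) c+m′≡m
                      (subst (_∣ (n C b) * (k ! * S b k)) (sym (^-distribˡ-+-* p c m′))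
                        (*-pres-∣ (valuation-∣ (n C b)) (stirling-lower-bound k b m′ budget′)))
      where
      c m′ : ℕ
      c  = ν p (n C b)
      m′ = m ∸ c
      c+m′≡m : c + m′ ≡ m
      c+m′≡m = m+[n∸m]≡n (<⇒≤ (≰⇒> m≰c))
      budget′ : (p ∸ 1) * m′ + σ p b < k + (p ∸ 1)
      budget′ = shift-budget (p ∸ 1) c m′ (σ p n) (σ p b) (σ p (n ∸ b)) k
                  (subst (λ e → (p ∸ 1) * e + σ p n < suc k + (p ∸ 1)) (sym c+m′≡m) budget)
                  (binomial-valuation (<⇒≤ b<n)) (σ-positive (n ∸ b) (m<n⇒0<n∸m b<n))

  -- In a minimum zero case, p^{ν+1} (ν = ν_p(S(n,k))) divides the term (k+1) S(n,k+1)
  -- of the recurrence for S(n+1,k+1): apply the lower bound at level k+1 and cancel k!.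
  first-term-divisible : ∀ n k → MinimumZeroCase p n k → p ^ suc (ν p (S n k)) ∣ suc k * S n (suc k)
  first-term-divisible n k minZero =
    valuation-cancel (k !) (suc v) (factorial-positive k)
      (subst (p ^ (ν p (k !) + suc v) ∣_) (regroup (suc k) (k !) (S n (suc k)))
        (stirling-lower-bound (suc k) n (ν p (k !) + suc v) (≤-reflexive (cong suc budget≡))))
    where
    v : ℕ
    v = ν p (S n k)
    budget≡ : (p ∸ 1) * (ν p (k !) + suc v) + σ p n ≡ k + (p ∸ 1)
    budget≡ = begin
      (p ∸ 1) * (ν p (k !) + suc v) + σ p n          ≡⟨ expand (p ∸ 1) (ν p (k !)) v (σ p n) ⟩
      ((p ∸ 1) * ν p (k !) + ((p ∸ 1) * v + σ p n)) + (p ∸ 1)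
                                                     ≡⟨ cong (λ s → (p ∸ 1) * ν p (k !) + s + (p ∸ 1)) minZero ⟩
      ((p ∸ 1) * ν p (k !) + σ p k) + (p ∸ 1)        ≡⟨ cong (_+ (p ∸ 1)) (legendre k) ⟩
      k + (p ∸ 1)                                    ∎
      where
      open ≡-Reasoning
      expand : ∀ q l v s → q * (l + suc v) + s ≡ (q * l + (q * v + s)) + q
      expand = solve-∀
    regroup : ∀ a f s → (a * f) * s ≡ f * (a * s)
    regroup = solve-∀

  valuation-of-sum : ∀ v w e → p ∤ e →
    ν p (p ^ suc v * w + p ^ v * e) ≡ v × ε p (p ^ suc v * w + p ^ v * e) % p ≡ e % p
  valuation-of-sum v w e p∤e =
    subst (λ y → ν p y ≡ v × ε p y % p ≡ e % p) (sym (factor-out (p ^ v) p w e))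
      (ν-unique v (w * p + e) p∤unit ,
       trans (cong (_% p) (ε-unique v (w * p + e) p∤unit)) (%-remove-+ˡ e (n∣m*n w)))
    where
    factor-out : ∀ x q w e → q * x * w + x * e ≡ x * (w * q + e)
    factor-out = solve-∀
    p∤unit : p ∤ w * p + e
    p∤unit p∣unit = p∤e (∣m+n∣m⇒∣n p∣unit (n∣m*n w))

  minimum-zero-propagates : ∀ n k → 0 < S n k → MinimumZeroCase p n k →
    (ν p (S (suc n) (suc k)) ≡ ν p (S n k)) × (ε p (S (suc n) (suc k)) % p ≡ ε p (S n k) % p)
  minimum-zero-propagates n k 0<S minZero =
    subst (λ y → ν p y ≡ v × ε p y % p ≡ e % p) (sym recurrence) (valuation-of-sum v w e p∤e)
    where
    v e w : ℕ
    v = ν p (S n k)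
    e = ε p (S n k)
    p^[v+1]∣first : p ^ suc v ∣ suc k * S n (suc k)
    p^[v+1]∣first = first-term-divisible n k minZero
    w = quotient p^[v+1]∣first
    p∤e : p ∤ e
    p∤e = proj₂ (ν-ε-split (S n k) 0<S)
    recurrence : S (suc n) (suc k) ≡ p ^ suc v * w + p ^ v * e
    recurrence = cong₂ _+_ (trans (_∣_.equality p^[v+1]∣first) (*-comm w (p ^ suc v))) (proj₁ (ν-ε-split (S n k) 0<S))

theorem2p5 : (p : ℕ) → .{{_ : NonZero p}} → Prime p → (n k : ℕ) → 1 ≤ k → k ≤ n →
    MinimumZeroCase p n k →
    (ν p (S (suc n) (suc k)) ≡ ν p (S n k)) × (ε p (S (suc n) (suc k)) % p ≡ ε p (S n k) % p)
theorem2p5 p p-prime n       zero    ()        _         _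
theorem2p5 p p-prime zero    (suc k) _         ()        _
theorem2p5 p p-prime (suc n) (suc k) (s≤s z≤n) (s≤s k≤n) minZero =
  PrimeValuation.minimum-zero-propagates p p-prime (suc n) (suc k) (S-positive k≤n) minZero
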